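{- Let $I$ be a $b$-nested common interval of $\mathcal{P}$ with $D(I)=\{x_1, x_2, \ldots, x_r\}$, $r\geq 1$. Then each of the intervals $Int(x_i)$, $1\leq i\leq r$, is either a $b$-small or a $b$-nested common interval.
   Context: Let $\mathcal{P}=\{P_1,\ldots,P_K\}$ be a set of $K$ permutations on $\{1,\ldots,n\}$ with $P_1=Id_n=(1,2,\ldots,n)$, so every common interval (a set of integers that is an interval, i.e. a set of consecutive elements, in every $P_k$) has the form $(i..j)=\{i,i+1,\ldots,j\}$. Let $b$ be a positive integer. A common interval $I$ is $b$-nested if $|I|=1$ or $I$ strictly contains a $b$-nested common interval of size at least $|I|-b$; it is $b$-small if $|I|\le b$ and $b$-large otherwise. An interval $(i..j)$ overlaps $(k..l)$ if $i<k\le j<l$ or $k<i\le l<j$; a common interval is strong if it overlaps no other common interval. Let $T$ be the PQ-tree of the common intervals of $\mathcal{P}$: its nodes are in bijection with the strong common intervals (node $x$ corresponds to the interval $Int(x)$, the root to $(1..n)$, leaves to singletons), its arcs are the direct inclusions between strong intervals, each node is labeled $P$ or $Q$, the children $y_1,\ldots,y_r$ of a $Q$-node are ordered so that $\max(Int(y_i))+1=\min(Int(y_{i+1}))$, and an interval is common iff it corresponds to a node or is the union of the intervals of consecutive children of a unique $Q$-node. For a common interval $I$, its domain $D(I)$ is: the set of children of the node $x$ with $Int(x)=I$ if $I$ is strong; otherwise the set $\{x_l,\ldots,x_r\}$ of consecutive children of the unique $Q$-node $z$ such that $I=\bigcup_{i=l}^{r} Int(x_i)$. -}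

module Defs where

open import Data.Nat using (ℕ; zero; suc; _+_; _∸_; _≤_; _<_)
open import Data.Fin using (Fin; toℕ)
open import Data.Fin.Permutation using (Permutation′; _⟨$⟩ˡ_)
open import Data.Product using (Σ; _×_; _,_)
open import Data.Sum using (_⊎_)
open import Relation.Nullary using (¬_)
open import Relation.Binary.PropositionalEquality using (_≡_; _≢_)

-- Conventions: the ground set {1,…,n} is represented 0-based as Fin n
-- (element x ↦ toℕ x).  A permutation P is the sequence
-- (P ⟨$⟩ʳ 0, …, P ⟨$⟩ʳ (n-1)); the position of element x in P is P ⟨$⟩ˡ x.
-- Since P₁ = Id, every common interval is a range (i..j); we represent
-- (i..j) = {i, i+1, …, j} by the pair (i , j).

Interval : Set
Interval = ℕ × ℕ

lo hi : Interval → ℕ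
lo (i , _) = i
hi (_ , j) = j

size : Interval → ℕ
size (i , j) = suc j ∸ i

_∈I_ : ℕ → Interval → Set
x ∈I (i , j) = i ≤ x × x ≤ j

_⊆I_ : Interval → Interval → Set
(i , j) ⊆I (k , l) = k ≤ i × j ≤ l

_⊊I_ : Interval → Interval → Set
I ⊊I J = I ⊆I J × I ≢ J

IsIntervalIn : {n : ℕ} → Permutation′ n → ℕ → ℕ → Set
IsIntervalIn {n} π i j =
  Σ ℕ λ p → (x : Fin n) →
    ((i ≤ toℕ x × toℕ x ≤ j) → (p ≤ toℕ (π ⟨$⟩ˡ x) × toℕ (π ⟨$⟩ˡ x) ≤ p + (j ∸ i)))
  × ((p ≤ toℕ (π ⟨$⟩ˡ x) × toℕ (π ⟨$⟩ˡ x) ≤ p + (j ∸ i)) → (i ≤ toℕ x × toℕ x ≤ j))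

-- The family 𝒫 = {P_0,…,P_K'} is given as  P : Fin K → Permutation′ n.
module _ {n K : ℕ} (P : Fin K → Permutation′ n) where

  Common : Interval → Set
  Common (i , j) = i ≤ j × j < n × ((k : Fin K) → IsIntervalIn (P k) i j)

  Overlaps : Interval → Interval → Set
  Overlaps (i , j) (k , l) = (i < k × k ≤ j × j < l) ⊎ (k < i × i ≤ l × l < j)

  Strong : Interval → Set
  Strong I = Common I × ((J : Interval) → Common J → ¬ Overlaps I J)

  -- arcs of the PQ-tree: J is a child of the node Z iff the inclusion of the
  -- strong interval J in the strong interval Z is direct
  Child : Interval → Interval → Set
  Child Z J = Strong Z × Strong J × J ⊊I Z
            × ((K' : Interval) → Strong K' → J ⊊I K' → ¬ (K' ⊊I Z))

  -- J ∈ D(I), i.e. J = Int(x) for some x in the domain of I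
  Domain : Interval → Interval → Set
  Domain I J =
      (Strong I × Child I J)
    ⊎ (Common I × ¬ Strong I ×
       Σ Interval λ Z → Child Z J × J ⊆I I × I ⊆I Z ×
         ((x : ℕ) → x ∈I I → Σ Interval λ J' → Child Z J' × J' ⊆I I × x ∈I J'))

  module _ (b : ℕ) where

    Small : Interval → Set
    Small I = size I ≤ b

    data Nested : Interval → Set where
      single : {I : Interval} → Common I → size I ≡ 1 → Nested I
      step   : {I J : Interval} → Common I → Nested J → J ⊊I I
             → size I ∸ b ≤ size J → Nested I

-- Induct on the nesting of I, descending along I = I₀ ⊋ I₁ ⊋ … with |Iₖ₊₁| ≥ |Iₖ| - b.
-- Every element J of D(I) is a strong interval contained in I, so it does not
-- overlap the common interval I₁: either J ⊇ I₁, and then J inherits the nesting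
-- of I₁ (its size is at most |I|); or J ⊆ I₁, and we recurse; or J and I₁ are
-- disjoint inside I, and then |J| ≤ |I| - |I₁| ≤ b.  At a singleton, |J| ≤ 1 ≤ b.
module Submission where

open import Defs
open import Data.Nat using (ℕ; suc; _≤_; _<_; _+_; _∸_; _≟_; _≤?_; s≤s)
open import Data.Nat.Properties
open import Data.Fin using (Fin; zero)
open import Data.Fin.Permutation using (Permutation′; _⟨$⟩ʳ_)
open import Data.Product using (Σ; _×_; _,_; proj₁)
open import Data.Product.Properties using (≡-dec)
open import Data.Sum using (_⊎_; inj₁; inj₂)
open import Relation.Nullary using (¬_; yes; no; contradiction)
open import Relation.Binary.PropositionalEquality using (_≡_; refl; sym; cong; cong₂; subst; module ≡-Reasoning)

size-mono-⊆I : ∀ {I J} → I ⊆I J → size I ≤ size J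
size-mono-⊆I (k≤i , j≤l) = ∸-mono (s≤s j≤l) k≤i

size-concat : ∀ {i q j} → i ≤ suc q → q ≤ j → size (i , q) + size (suc q , j) ≡ size (i , j)
size-concat {i} {q} {j} i≤1+q q≤j = begin
  (suc q ∸ i) + (j ∸ q)       ≡⟨ +-∸-assoc (suc q ∸ i) q≤j ⟨
  (suc q ∸ i) + j ∸ q         ≡⟨ cong (_∸ q) (+-∸-comm j i≤1+q) ⟨
  suc q + j ∸ i ∸ q           ≡⟨ ∸-+-assoc (suc q + j) i q ⟩
  suc q + j ∸ (i + q)         ≡⟨ cong₂ _∸_ (sym (+-suc q j)) (+-comm i q) ⟩
  q + suc j ∸ (q + i)         ≡⟨ [m+n]∸[m+o]≡n∸o q (suc j) i ⟩
  suc j ∸ i                   ∎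
  where open ≡-Reasoning

size-disjoint : ∀ {I J K} → lo J ≤ hi J → J ⊆I I → K ⊆I I → hi J < lo K
              → size J + size K ≤ size I
size-disjoint {i , j} {p , q} {c , d} p≤q (i≤p , q≤j) (_ , d≤j) q<c = begin
  size (p , q) + size (c , d)       ≤⟨ +-mono-≤ (size-mono-⊆I (i≤p , ≤-refl)) (size-mono-⊆I (q<c , d≤j)) ⟩
  size (i , q) + size (suc q , j)   ≡⟨ size-concat (≤-trans i≤p (m≤n⇒m≤1+n p≤q)) q≤j ⟩
  size (i , j)                      ∎
  where open ≤-Reasoning

m+n≤o⇒o∸b≤n⇒m≤b : ∀ {m n o} b → m + n ≤ o → o ∸ b ≤ n → m ≤ b
m+n≤o⇒o∸b≤n⇒m≤b {m} {n} {o} b m+n≤o o∸b≤n = +-cancelʳ-≤ n m b (begin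
  m + n         ≤⟨ m+n≤o ⟩
  o             ≤⟨ m≤n+m∸n o b ⟩
  b + (o ∸ b)   ≤⟨ +-monoʳ-≤ b o∸b≤n ⟩
  b + n         ∎)
  where open ≤-Reasoning

module _ {n K : ℕ} (P : Fin K → Permutation′ n) where

  nonOverlapping-placement : ∀ {J J'} → ¬ Overlaps P J J'
    → J' ⊆I J ⊎ J ⊆I J' ⊎ hi J < lo J' ⊎ hi J' < lo J
  nonOverlapping-placement {p , q} {c , d} ¬ov with p ≤? c
  ... | yes p≤c with d ≤? q
  ...   | yes d≤q = inj₁ (p≤c , d≤q)
  ...   | no d≰q with c ≤? q
  ...     | no c≰q = inj₂ (inj₂ (inj₁ (≰⇒> c≰q)))
  ...     | yes c≤q with p ≟ c
  ...       | yes refl = inj₂ (inj₁ (≤-refl , <⇒≤ (≰⇒> d≰q)))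
  ...       | no p≢c = contradiction (inj₁ (≤∧≢⇒< p≤c p≢c , c≤q , ≰⇒> d≰q)) ¬ov
  nonOverlapping-placement {p , q} {c , d} ¬ov | no p≰c with q ≤? d
  ... | yes q≤d = inj₂ (inj₁ (<⇒≤ (≰⇒> p≰c) , q≤d))
  ... | no q≰d with p ≤? d
  ...   | yes p≤d = contradiction (inj₂ (≰⇒> p≰c , p≤d , ≰⇒> q≰d)) ¬ov
  ...   | no p≰d = inj₂ (inj₂ (inj₂ (≰⇒> p≰d)))

  domain⇒strong×⊆I : ∀ {I J} → Domain P I J → Strong P J × J ⊆I I
  domain⇒strong×⊆I (inj₁ (_ , _ , sJ , (J⊆I , _) , _)) = sJ , J⊆I
  domain⇒strong×⊆I (inj₂ (_ , _ , _ , (_ , sJ , _) , J⊆I , _)) = sJ , J⊆I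

  module _ (b : ℕ) where

    nested⇒common : ∀ {I} → Nested P b I → Common P I
    nested⇒common (single cI _) = cI
    nested⇒common (step cI _ _ _) = cI

    nested-⊆I : ∀ {I J} → Common P I → Nested P b J → J ⊆I I → size I ∸ b ≤ size J
              → Nested P b I
    nested-⊆I {I} {J} cI nJ J⊆I hs with ≡-dec _≟_ _≟_ J I
    ... | yes refl = nJ
    ... | no J≢I = step cI nJ (J⊆I , J≢I) hs

    strong-⊆I-nested⇒small⊎nested : 1 ≤ b → ∀ {I J} → Nested P b I → Strong P J → J ⊆I I
                                   → Small P b J ⊎ Nested P b J
    strong-⊆I-nested⇒small⊎nested 1≤b (single _ |I|≡1) _ J⊆I =
      inj₁ (≤-trans (size-mono-⊆I J⊆I) (subst (_≤ b) (sym |I|≡1) 1≤b))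
    strong-⊆I-nested⇒small⊎nested 1≤b {I} {J} (step {J = J'} _ nJ' (J'⊆I , _) hs) sJ@(cJ , ¬ovJ) J⊆I
      with nested⇒common nJ'
    ... | cJ'@(lo≤hiJ' , _) with nonOverlapping-placement (¬ovJ _ cJ')
    ... | inj₁ J'⊆J =
      inj₂ (nested-⊆I cJ nJ' J'⊆J (≤-trans (∸-monoˡ-≤ b (size-mono-⊆I J⊆I)) hs))
    ... | inj₂ (inj₁ J⊆J') = strong-⊆I-nested⇒small⊎nested 1≤b nJ' sJ J⊆J'
    ... | inj₂ (inj₂ (inj₁ J<J')) =
      inj₁ (m+n≤o⇒o∸b≤n⇒m≤b b (size-disjoint (proj₁ cJ) J⊆I J'⊆I J<J') hs)
    ... | inj₂ (inj₂ (inj₂ J'<J)) =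
      inj₁ (m+n≤o⇒o∸b≤n⇒m≤b b
        (subst (_≤ size I) (+-comm (size J') (size J)) (size-disjoint lo≤hiJ' J'⊆I J⊆I J'<J)) hs)

lemma1 : (n K : ℕ) (P : Fin (suc K) → Permutation′ n)
    → ((x : Fin n) → P zero ⟨$⟩ʳ x ≡ x)
    → (b : ℕ) → 1 ≤ b
    → (I : Interval) → Nested P b I
    → Σ Interval (λ J → Domain P I J)
    → (J : Interval) → Domain P I J
    → Small P b J ⊎ Nested P b J
lemma1 n K P _ b 1≤b I nI _ J J∈D =
  let sJ , J⊆I = domain⇒strong×⊆I P J∈D
  in strong-⊆I-nested⇒small⊎nested P b 1≤b nI sJ J⊆I
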